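{- For any positive integers $k$ and $t$ with $3k+1=2^{t-1}$, there exists a cubic graph $G$ on $n=8k+2$ vertices which, for the constant threshold assignment $\tau(v)=2$ for all $v\in V(G)$, contains a $\tau$-WDM $D$ with processing time $t$ and $|D|=(n+2)/4$.
   Context: A set $D\subseteq V(G)$ is a $\tau$-weak dynamic monopoly ($\tau$-WDM) with processing time $t$ if $V(G)$ can be partitioned into $D_0=D,D_1,\ldots,D_t$ such that for every $i\in\{1,\ldots,t\}$, every vertex $v\in D_i$ has at least $\tau(v)$ neighbors in $D_{i-1}$. -}

module Defs where

open import Data.Nat using (ℕ; zero; suc; _+_; _*_; _≥_)
open import Data.Fin using (Fin; toℕ)
open import Data.List using (List; length; filter)
open import Data.List.Base using (allFin)
open import Data.Bool using (Bool; true; false; T)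
open import Data.Bool.Properties using (T?)
open import Data.Product using (Σ; ∃; _×_; _,_)
open import Relation.Binary.PropositionalEquality using (_≡_)
open import Relation.Nullary.Decidable using (_×-dec_)
import Data.Nat.Properties as ℕP

record Graph (n : ℕ) : Set where
  field
    adj   : Fin n → Fin n → Bool
    sym   : ∀ u v → adj u v ≡ adj v u
    irref : ∀ v → adj v v ≡ false

open Graph public

degree : ∀ {n} (G : Graph n) → Fin n → ℕ
degree {n} G v = length (filter (λ w → T? (adj G v w)) (allFin n))

Cubic : ∀ {n} → Graph n → Set
Cubic G = ∀ v → degree G v ≡ 3

-- A partition D_0, …, D_t of V(G) is encoded by a layer map
-- layer : Fin n → Fin (suc t), with D_i = { v | toℕ (layer v) ≡ i }.

nbrsInLayer : ∀ {n t} (G : Graph n) (layer : Fin n → Fin (suc t)) → Fin n → ℕ → ℕ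
nbrsInLayer {n} G layer v i =
  length (filter (λ w → T? (adj G v w) ×-dec (toℕ (layer w) ℕP.≟ i)) (allFin n))

layerSize : ∀ {n t} (layer : Fin n → Fin (suc t)) → ℕ → ℕ
layerSize {n} layer i = length (filter (λ w → toℕ (layer w) ℕP.≟ i) (allFin n))

-- D is a τ-WDM with processing time t, witnessed by the partition `layer`:
-- D = D_0, every D_i (0 ≤ i ≤ t) is a (nonempty) part, and every v ∈ D_i with
-- i ≥ 1 has at least τ(v) neighbours in D_{i-1}.
IsWDMPartition : ∀ {n} (G : Graph n) (τ : Fin n → ℕ) (t : ℕ)
                 (layer : Fin n → Fin (suc t)) → Set
IsWDMPartition {n} G τ t layer =
  (∀ i → layerSize layer (toℕ {suc t} i) ≥ 1) ×
  (∀ v i → toℕ (layer v) ≡ suc i → nbrsInLayer G layer v i ≥ τ v)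

HasWDMOfSize : ∀ {n} (G : Graph n) (τ : Fin n → ℕ) (t d : ℕ) → Set
HasWDMOfSize G τ t d =
  Σ (Fin _ → Fin (suc t)) λ layer → IsWDMPartition G τ t layer × layerSize layer 0 ≡ d

module Submission where

-- Proposition 1.  Let m = 2k + 1 and L = 3k + 1 = 2^h, so t = h + 1 and
-- n = 8k + 2 = 2k + 2L.  The vertices 0, …, m - 1 are the x-vertices x_r; the
-- vertex 2k + j (1 ≤ j < 2L) is node j of a complete binary tree in heap
-- numbering (children 2j and 2j + 1, parent ⌊j/2⌋), with leaves L, …, 2L - 1.
-- The x-vertices are joined to the tree along 2L + 1 = 3m slots: slot s < 2L
-- joins x_(s mod m) to the leaf L + ⌊s/2⌋, and the last slot 2L joins x_(2k)
-- to the root.  Taking D = {x_r},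
-- of size m = (n + 2)/4, and putting node j into layer h + 1 - ⌊log₂ j⌋, each
-- leaf has its two x-neighbours in D_0 and each internal node its two children
-- one layer below, so D is a 2-WDM with processing time t.

open import Defs hiding (sym)
open import Data.Nat using (ℕ; zero; suc; _+_; _*_; _∸_; _^_; _≤_; _<_; _≥_; z≤n; s≤s; ⌊_/2⌋)
open import Data.Nat.Properties
open import Data.Nat.DivMod using (_%_; _/_; m≡m%n+[m/n]*n; m%n<n; [m+kn]%n≡m%n; m<n⇒m%n≡m; n%n≡0; %-distribˡ-+; m<n*o⇒m/o<n)
open import Data.Nat.Logarithm using (⌊log₂_⌋; ⌊log₂⌋-mono-≤; ⌊log₂⌊n/2⌋⌋≡⌊log₂n⌋∸1; ⌊log₂[2^n]⌋≡n)
open import Data.Nat.Tactic.RingSolver using (solve-∀)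
open import Data.Fin using (Fin; toℕ; fromℕ<)
open import Data.Fin.Properties using (toℕ-fromℕ<; toℕ-injective; toℕ<n)
open import Data.Bool using (Bool)
open import Data.Bool.Properties using (T?)
open import Data.Empty using (⊥)
open import Data.List using (List; []; _∷_; length; filter; map; upTo)
open import Data.List.Base using (allFin)
open import Data.List.Properties using (length-map; filter-some; filter-accept; length-upTo)
open import Data.List.Relation.Unary.All as All using (All; []; _∷_)
import Data.List.Relation.Unary.All.Properties as AllP
open import Data.List.Relation.Unary.AllPairs using ([]; _∷_)
open import Data.List.Relation.Unary.Any using (here; there)
open import Data.List.Relation.Unary.Unique.Propositional using (Unique)
import Data.List.Relation.Unary.Unique.Propositional.Properties as Unique
open import Data.List.Membership.Propositional using (_∈_; _∉_; lose)
open import Data.List.Membership.Propositional.Properties using (∈-allFin; ∈-map⁺; ∈-map⁻; ∈-filter⁺; ∈-filter⁻; ∈-upTo⁺; ∈-upTo⁻)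
open import Data.List.Membership.Propositional.Properties.WithK using (unique∧set⇒bag)
open import Data.List.Membership.DecPropositional _≟_ using (_∈?_)
open import Data.List.Relation.Binary.BagAndSetEquality using (_∼[_]_; set; ∼bag⇒↭)
open import Data.List.Relation.Binary.Permutation.Propositional.Properties using (↭-length)
open import Data.Sum using (_⊎_; inj₁; inj₂)
open import Data.Product using (Σ; ∃-syntax; _×_; _,_; proj₁; proj₂)
open import Function.Bundles using (mk⇔)
open import Level using (0ℓ)
open import Relation.Nullary using (Dec; yes; no; contradiction)
open import Relation.Nullary.Decidable using (does; isYes; isYes≗does; does-⇔; dec-false; toWitness; fromWitness; _×-dec_)
open import Relation.Unary using (Pred; Decidable)
open import Relation.Binary.PropositionalEquality using (_≡_; _≢_; refl; sym; trans; cong; subst; subst₂; module ≡-Reasoning)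

double-suc : ∀ p → 2 * suc p ≡ suc (suc (2 * p))
double-suc p = cong suc (+-suc p (p + 0))

half-double : ∀ p → ⌊ 2 * p /2⌋ ≡ p
half-double zero = refl
half-double (suc p) = trans (cong ⌊_/2⌋ (double-suc p)) (cong suc (half-double p))

half-suc-double : ∀ p → ⌊ suc (2 * p) /2⌋ ≡ p
half-suc-double zero = refl
half-suc-double (suc p) = trans (cong (λ x → ⌊ suc x /2⌋) (double-suc p)) (cong suc (half-suc-double p))

parity : ∀ j → j ≡ 2 * ⌊ j /2⌋ ⊎ j ≡ suc (2 * ⌊ j /2⌋)
parity zero = inj₁ refl
parity (suc zero) = inj₂ refl
parity (suc (suc j)) with parity j
... | inj₁ even = inj₁ (trans (cong (λ x → suc (suc x)) even) (sym (double-suc ⌊ j /2⌋)))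
... | inj₂ odd  = inj₂ (trans (cong (λ x → suc (suc x)) odd) (cong suc (sym (double-suc ⌊ j /2⌋))))

half-< : ∀ {j b} → j < 2 * b → ⌊ j /2⌋ < b
half-< {j} {b} j<2b = *-cancelˡ-< 2 ⌊ j /2⌋ b (≤-<-trans (double-half-≤ (parity j)) j<2b)
  where
  double-half-≤ : j ≡ 2 * ⌊ j /2⌋ ⊎ j ≡ suc (2 * ⌊ j /2⌋) → 2 * ⌊ j /2⌋ ≤ j
  double-half-≤ (inj₁ even) = ≤-reflexive (sym even)
  double-half-≤ (inj₂ odd)  = ≤-trans (n≤1+n _) (≤-reflexive (sym odd))

half-<-self : ∀ {j} → 1 ≤ j → ⌊ j /2⌋ < j
half-<-self {suc j} _ = ⌊n/2⌋<n j

⌊log₂⌋-positive : ∀ {c} → 2 ≤ c → 1 ≤ ⌊log₂ c ⌋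
⌊log₂⌋-positive {c} 2≤c = subst (_≤ ⌊log₂ c ⌋) (⌊log₂[2^n]⌋≡n 1) (⌊log₂⌋-mono-≤ 2≤c)

⌊log₂⌋-half : ∀ c → 2 ≤ c → ⌊log₂ c ⌋ ≡ suc ⌊log₂ ⌊ c /2⌋ ⌋
⌊log₂⌋-half c 2≤c with ⌊log₂ c ⌋ | ⌊log₂⌊n/2⌋⌋≡⌊log₂n⌋∸1 c | ⌊log₂⌋-positive 2≤c
... | suc l | halved | _ = cong suc (sym halved)
... | zero  | _      | ()

⌊log₂⌋-< : ∀ d j → j < 2 ^ suc d → ⌊log₂ j ⌋ ≤ d
⌊log₂⌋-< d zero _ = z≤n
⌊log₂⌋-< d (suc zero) _ = z≤n
⌊log₂⌋-< zero (suc (suc j)) (s≤s (s≤s ()))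
⌊log₂⌋-< (suc d) (suc (suc j)) j< =
  subst (_≤ suc d) (sym (⌊log₂⌋-half (suc (suc j)) (s≤s (s≤s z≤n))))
    (s≤s (⌊log₂⌋-< d ⌊ suc (suc j) /2⌋ (half-< j<)))

⌊log₂⌋-exact : ∀ d j → 2 ^ d ≤ j → j < 2 ^ suc d → ⌊log₂ j ⌋ ≡ d
⌊log₂⌋-exact d j lower upper = ≤-antisym (⌊log₂⌋-< d j upper)
  (subst (_≤ ⌊log₂ j ⌋) (⌊log₂[2^n]⌋≡n d) (⌊log₂⌋-mono-≤ lower))

count-exact : ∀ {n} {P : Pred (Fin n) 0ℓ} (P? : Decidable P) (ys : List ℕ) →
  Unique ys → All (_< n) ys →
  (∀ w → P w → toℕ w ∈ ys) → (∀ w → toℕ w ∈ ys → P w) →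
  length (filter P? (allFin n)) ≡ length ys
count-exact {n} {P} P? ys ys-unique ys-bounded sound complete = begin
  length (filter P? (allFin n)) ≡⟨ sym (length-map toℕ (filter P? (allFin n))) ⟩
  length xs                     ≡⟨ ↭-length (∼bag⇒↭ (unique∧set⇒bag xs-unique ys-unique same)) ⟩
  length ys                     ∎
  where
  open ≡-Reasoning
  xs : List ℕ
  xs = map toℕ (filter P? (allFin n))
  xs-unique : Unique xs
  xs-unique = Unique.map⁺ toℕ-injective (Unique.filter⁺ P? (Unique.allFin⁺ n))
  to : ∀ {z} → z ∈ xs → z ∈ ys
  to z∈xs with ∈-map⁻ toℕ z∈xs
  ... | w , w∈ , refl = sound w (proj₂ (∈-filter⁻ P? {xs = allFin n} w∈))
  from : ∀ {z} → z ∈ ys → z ∈ xs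
  from {z} z∈ys = subst (_∈ xs) (toℕ-fromℕ< z<n)
      (∈-map⁺ toℕ (∈-filter⁺ P? (∈-allFin w) (complete w (subst (_∈ ys) (sym (toℕ-fromℕ< z<n)) z∈ys))))
    where
    z<n : z < n
    z<n = All.lookup ys-bounded z∈ys
    w : Fin n
    w = fromℕ< z<n
  same : xs ∼[ set ] ys
  same = mk⇔ to from

record NeighbourSystem (n : ℕ) : Set where
  field
    nbrs      : ℕ → List ℕ
    in-range  : ∀ v → v < n → All (_< n) (nbrs v)
    distinct  : ∀ v → v < n → Unique (nbrs v)
    loopless  : ∀ v → v < n → v ∉ nbrs v
    symmetric : ∀ v w → v < n → w ∈ nbrs v → v ∈ nbrs w

module _ {n : ℕ} (S : NeighbourSystem n) where
  open NeighbourSystem S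

  systemGraph : Graph n
  systemGraph = record
    { adj   = adjacent
    ; sym   = λ u v → begin
        isYes (toℕ v ∈? nbrs (toℕ u)) ≡⟨ isYes≗does (toℕ v ∈? nbrs (toℕ u)) ⟩
        does (toℕ v ∈? nbrs (toℕ u))  ≡⟨ does-⇔ (mk⇔ (symmetric _ _ (toℕ<n u)) (symmetric _ _ (toℕ<n v)))
                                           (toℕ v ∈? nbrs (toℕ u)) (toℕ u ∈? nbrs (toℕ v)) ⟩
        does (toℕ u ∈? nbrs (toℕ v))  ≡⟨ sym (isYes≗does (toℕ u ∈? nbrs (toℕ v))) ⟩
        isYes (toℕ u ∈? nbrs (toℕ v)) ∎
    ; irref = λ v → trans (isYes≗does (toℕ v ∈? nbrs (toℕ v)))
                      (dec-false (toℕ v ∈? nbrs (toℕ v)) (loopless (toℕ v) (toℕ<n v)))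
    }
    where
    open ≡-Reasoning
    adjacent : Fin n → Fin n → Bool
    adjacent u v = isYes (toℕ v ∈? nbrs (toℕ u))

  systemGraph-degree : ∀ v → degree systemGraph v ≡ length (nbrs (toℕ v))
  systemGraph-degree v =
    count-exact (λ w → T? (adj systemGraph v w)) (nbrs (toℕ v))
      (distinct (toℕ v) (toℕ<n v)) (in-range (toℕ v) (toℕ<n v))
      (λ w → toWitness) (λ w → fromWitness)

module Layering {n : ℕ} (S : NeighbourSystem n) (t : ℕ) (lay : ℕ → ℕ)
                (lay≤t : ∀ v → v < n → lay v ≤ t) where
  open NeighbourSystem S

  layerMap : Fin n → Fin (suc t)
  layerMap w = fromℕ< (s≤s (lay≤t (toℕ w) (toℕ<n w)))

  toℕ-layerMap : ∀ w → toℕ (layerMap w) ≡ lay (toℕ w)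
  toℕ-layerMap w = toℕ-fromℕ< (s≤s (lay≤t (toℕ w) (toℕ<n w)))

  layerSize-layerMap : ∀ i (ys : List ℕ) → Unique ys → All (_< n) ys →
    (∀ v → v < n → lay v ≡ i → v ∈ ys) → (∀ v → v ∈ ys → lay v ≡ i) →
    layerSize layerMap i ≡ length ys
  layerSize-layerMap i ys ys-unique ys-bounded sound complete =
    count-exact (λ w → toℕ (layerMap w) ≟ i) ys ys-unique ys-bounded
      (λ w eq → sound (toℕ w) (toℕ<n w) (trans (sym (toℕ-layerMap w)) eq))
      (λ w w∈ys → trans (toℕ-layerMap w) (complete (toℕ w) w∈ys))

  nbrsInLayer-layerMap : ∀ v i →
    nbrsInLayer (systemGraph S) layerMap v i ≡ length (filter (λ w → lay w ≟ i) (nbrs (toℕ v)))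
  nbrsInLayer-layerMap v i =
    count-exact (λ w → T? (adj (systemGraph S) v w) ×-dec (toℕ (layerMap w) ≟ i)) ys
      (Unique.filter⁺ (λ w → lay w ≟ i) (distinct (toℕ v) (toℕ<n v)))
      (AllP.filter⁺ (λ w → lay w ≟ i) (in-range (toℕ v) (toℕ<n v)))
      (λ w (adjacent , in-i) → ∈-filter⁺ (λ w → lay w ≟ i) (toWitness adjacent)
                                 (trans (sym (toℕ-layerMap w)) in-i))
      (λ w w∈ys → let (listed , in-i) = ∈-filter⁻ (λ w → lay w ≟ i) w∈ys
                  in fromWitness listed , trans (toℕ-layerMap w) in-i)
    where
    ys : List ℕ
    ys = filter (λ w → lay w ≟ i) (nbrs (toℕ v))

  layerMap-WDM : ∀ τ →
    (∀ i → i ≤ t → ∃[ v ] v < n × lay v ≡ i) →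
    (∀ v i → v < n → lay v ≡ suc i → τ ≤ length (filter (λ w → lay w ≟ i) (nbrs v))) →
    IsWDMPartition (systemGraph S) (λ _ → τ) t layerMap
  layerMap-WDM τ inhabited supported = nonempty , threshold
    where
    nonempty : ∀ (i : Fin (suc t)) → layerSize layerMap (toℕ i) ≥ 1
    nonempty i with inhabited (toℕ i) (≤-pred (toℕ<n i))
    ... | v , v<n , lay-v = filter-some (λ w → toℕ (layerMap w) ≟ toℕ i)
          (lose (∈-allFin w) (trans (toℕ-layerMap w) (trans (cong lay (toℕ-fromℕ< v<n)) lay-v)))
      where
      w : Fin n
      w = fromℕ< v<n
    threshold : ∀ v i → toℕ (layerMap v) ≡ suc i → nbrsInLayer (systemGraph S) layerMap v i ≥ τ
    threshold v i in-layer = subst (τ ≤_) (sym (nbrsInLayer-layerMap v i))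
      (supported (toℕ v) i (toℕ<n v) (trans (sym (toℕ-layerMap v)) in-layer))

all3 : ∀ {P : ℕ → Set} {a b c} → P a → P b → P c → All P (a ∷ b ∷ c ∷ [])
all3 pa pb pc = pa ∷ pb ∷ pc ∷ []

distinct3 : ∀ {a b c : ℕ} → a ≢ b → a ≢ c → b ≢ c → Unique (a ∷ b ∷ c ∷ [])
distinct3 a≢b a≢c b≢c = (a≢b ∷ a≢c ∷ []) ∷ (b≢c ∷ []) ∷ [] ∷ []

not-in3 : ∀ {v a b c : ℕ} → v ≢ a → v ≢ b → v ≢ c → v ∉ a ∷ b ∷ c ∷ []
not-in3 v≢a v≢b v≢c (here eq) = v≢a eq
not-in3 v≢a v≢b v≢c (there (here eq)) = v≢b eq
not-in3 v≢a v≢b v≢c (there (there (here eq))) = v≢c eq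

two-in-layer : ∀ (lay : ℕ → ℕ) {i ns a b c} → ns ≡ a ∷ b ∷ c ∷ [] → lay a ≡ i → lay b ≡ i →
  2 ≤ length (filter (λ w → lay w ≟ i) ns)
two-in-layer lay {i} {a = a} {b} {c} refl a-in b-in =
  subst (λ ws → 2 ≤ length ws) (sym (begin
    filter (λ w → lay w ≟ i) (a ∷ b ∷ c ∷ [])     ≡⟨ filter-accept (λ w → lay w ≟ i) a-in ⟩
    a ∷ filter (λ w → lay w ≟ i) (b ∷ c ∷ [])     ≡⟨ cong (a ∷_) (filter-accept (λ w → lay w ≟ i) b-in) ⟩
    a ∷ b ∷ filter (λ w → lay w ≟ i) (c ∷ [])     ∎))
    (s≤s (s≤s z≤n))
  where open ≡-Reasoning

-- Numbers below
-- m are the x-vertices and node j is the number 2k + j; thus node 0 = 2k is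
-- x_(2k), which plays the role of the parent of the root node 1.
module Construction (k h : ℕ) (k≥1 : k ≥ 1) (leaves : 3 * k + 1 ≡ 2 ^ h) where

  m L n : ℕ
  m = suc (2 * k)
  L = suc (3 * k)
  n = 8 * k + 2

  node : ℕ → ℕ
  node j = 2 * k + j

  x-slots : 2 * k + 2 * m ≡ 2 * L
  x-slots = solve-∀-x k
    where
    solve-∀-x : ∀ k → 2 * k + 2 * suc (2 * k) ≡ 2 * suc (3 * k)
    solve-∀-x = solve-∀

  vertex-count : 2 * k + 2 * L ≡ n
  vertex-count = solve-∀-n k
    where
    solve-∀-n : ∀ k → 2 * k + 2 * suc (3 * k) ≡ 8 * k + 2
    solve-∀-n = solve-∀

  m≤n : m ≤ n
  m≤n = subst (m ≤_) (solve-∀-m k) (m≤m+n m (6 * k + 1))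
    where
    solve-∀-m : ∀ k → suc (2 * k) + (6 * k + 1) ≡ 8 * k + 2
    solve-∀-m = solve-∀

  L≡2^h : L ≡ 2 ^ h
  L≡2^h = trans (+-comm 1 (3 * k)) leaves

  L≤2L : L ≤ 2 * L
  L≤2L = m≤m+n L (L + 0)

  double-L : 2 * L ≡ L + L
  double-L = cong (L +_) (+-identityʳ L)

  3≤m : 3 ≤ m
  3≤m = s≤s (*-monoʳ-≤ 2 k≥1)

  2≤L : 2 ≤ L
  2≤L = s≤s (≤-trans k≥1 (m≤m+n k (2 * k)))

  leaf-≥1 : ∀ ℓ → 1 ≤ L + ℓ
  leaf-≥1 ℓ = ≤-trans (<⇒≤ 2≤L) (m≤m+n L ℓ)

  slotNode : ℕ → ℕ
  slotNode s with s <? 2 * L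
  ... | yes _ = node (L + ⌊ s /2⌋)
  ... | no _  = node 1

  xNbrs : ℕ → List ℕ
  xNbrs r = slotNode (r + 0 * m) ∷ slotNode (r + 1 * m) ∷ slotNode (r + 2 * m) ∷ []

  nodeNbrs : ℕ → List ℕ
  nodeNbrs j with j <? L
  ... | yes _ = node (2 * j) ∷ node (suc (2 * j)) ∷ node ⌊ j /2⌋ ∷ []
  ... | no _  = (2 * (j ∸ L)) % m ∷ (suc (2 * (j ∸ L))) % m ∷ node ⌊ j /2⌋ ∷ []

  nbrs : ℕ → List ℕ
  nbrs v with v <? m
  ... | yes _ = xNbrs v
  ... | no _  = nodeNbrs (v ∸ 2 * k)

  slotNode-leaf : ∀ s → s < 2 * L → slotNode s ≡ node (L + ⌊ s /2⌋)
  slotNode-leaf s s<2L with s <? 2 * L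
  ... | yes _   = refl
  ... | no s≮2L = contradiction s<2L s≮2L

  slotNode-root : slotNode (2 * L) ≡ node 1
  slotNode-root with 2 * L <? 2 * L
  ... | yes 2L<2L = contradiction 2L<2L (<-irrefl refl)
  ... | no _      = refl

  node-≥m : ∀ {j} → 1 ≤ j → m ≤ node j
  node-≥m {j} 1≤j = subst (_≤ node j) (+-comm (2 * k) 1) (+-monoʳ-≤ (2 * k) 1≤j)

  nbrs-x : ∀ r → r < m → nbrs r ≡ xNbrs r
  nbrs-x r r<m with r <? m
  ... | yes _  = refl
  ... | no r≮m = contradiction r<m r≮m

  nbrs-node : ∀ j → 1 ≤ j → nbrs (node j) ≡ nodeNbrs j
  nbrs-node j 1≤j with node j <? m
  ... | yes j<m = contradiction (node-≥m 1≤j) (<⇒≱ j<m)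
  ... | no _    = cong nodeNbrs (m+n∸m≡n (2 * k) j)

  nbrs-inner : ∀ j → 1 ≤ j → j < L →
    nbrs (node j) ≡ node (2 * j) ∷ node (suc (2 * j)) ∷ node ⌊ j /2⌋ ∷ []
  nbrs-inner j 1≤j j<L with j <? L | nbrs-node j 1≤j
  ... | yes _  | eq = eq
  ... | no j≮L | _  = contradiction j<L j≮L

  nbrs-leaf : ∀ ℓ → ℓ < L →
    nbrs (node (L + ℓ)) ≡ (2 * ℓ) % m ∷ (suc (2 * ℓ)) % m ∷ node ⌊ (L + ℓ) /2⌋ ∷ []
  nbrs-leaf ℓ ℓ<L with L + ℓ <? L | nbrs-node (L + ℓ) (leaf-≥1 ℓ)
  ... | yes L+ℓ<L | _  = contradiction L+ℓ<L (m+n≮m L ℓ)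
  ... | no _      | eq = trans eq (cong (λ i → (2 * i) % m ∷ (suc (2 * i)) % m ∷ node ⌊ (L + ℓ) /2⌋ ∷ [])
                                        (m+n∸m≡n L ℓ))

  nbrs-parent : ∀ j → 1 ≤ j → node ⌊ j /2⌋ ∈ nbrs (node j)
  nbrs-parent j 1≤j = subst (node ⌊ j /2⌋ ∈_) (sym (nbrs-node j 1≤j)) parent-listed
    where
    parent-listed : node ⌊ j /2⌋ ∈ nodeNbrs j
    parent-listed with j <? L
    ... | yes _ = there (there (here refl))
    ... | no _  = there (there (here refl))

  data Vertex : ℕ → Set where
    x-vertex : ∀ r → r < m → Vertex r
    inner    : ∀ j → 1 ≤ j → j < L → Vertex (node j)
    leaf     : ∀ ℓ → ℓ < L → Vertex (node (L + ℓ))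

  tree-vertex : ∀ j → 1 ≤ j → j < 2 * L → Vertex (node j)
  tree-vertex j 1≤j j<2L with j <? L
  ... | yes j<L = inner j 1≤j j<L
  ... | no j≮L  = subst (λ i → Vertex (node i)) (m+[n∸m]≡n L≤j)
                    (leaf (j ∸ L) (+-cancelˡ-< L (j ∸ L) L
                      (subst (_< L + L) (sym (m+[n∸m]≡n L≤j)) (subst (j <_) double-L j<2L))))
    where
    L≤j : L ≤ j
    L≤j = ≮⇒≥ j≮L

  vertex : ∀ v → v < n → Vertex v
  vertex v v<n with v <? m
  ... | yes v<m = x-vertex v v<m
  ... | no v≮m  = subst Vertex (m+[n∸m]≡n 2k≤v) (tree-vertex (v ∸ 2 * k) (m<n⇒0<n∸m (≮⇒≥ v≮m))
                    (+-cancelˡ-< (2 * k) (v ∸ 2 * k) (2 * L)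
                      (subst₂ _<_ (sym (m+[n∸m]≡n 2k≤v)) (sym vertex-count) v<n)))
    where
    2k≤v : 2 * k ≤ v
    2k≤v = ≤-trans (n≤1+n (2 * k)) (≮⇒≥ v≮m)

  node-< : ∀ {j} → j < 2 * L → node j < n
  node-< {j} j<2L = subst (node j <_) vertex-count (+-monoʳ-< (2 * k) j<2L)

  node-mono : ∀ {i j} → i < j → node i < node j
  node-mono = +-monoʳ-< (2 * k)

  x<node : ∀ {r j} → r < m → 1 ≤ j → r < node j
  x<node r<m 1≤j = <-≤-trans r<m (node-≥m 1≤j)

  children-< : ∀ {j} → j < L → suc (2 * j) < 2 * L
  children-< {j} j<L = subst (_≤ 2 * L) (double-suc j) (*-monoʳ-≤ 2 j<L)

  leaf-< : ∀ {ℓ} → ℓ < L → L + ℓ < 2 * L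
  leaf-< {ℓ} ℓ<L = subst (L + ℓ <_) (sym double-L) (+-monoʳ-< L ℓ<L)

  slot-bound : ∀ {r} q → r < m → q ≤ 2 → r + q * m ≤ 2 * L
  slot-bound {r} q r<m q≤2 =
    subst (r + q * m ≤_) x-slots (+-mono-≤ (≤-pred r<m) (*-monoˡ-≤ m q≤2))

  slotNode-range : ∀ s → m ≤ slotNode s × slotNode s < n
  slotNode-range s with s <? 2 * L
  ... | yes s<2L = node-≥m (leaf-≥1 ⌊ s /2⌋)
                 , node-< (subst (L + ⌊ s /2⌋ <_) (sym double-L)
                     (+-monoʳ-< L (half-< s<2L)))
  ... | no _     = node-≥m ≤-refl , node-< (≤-trans 2≤L (m≤m+n L (L + 0)))

  slotNode-separated : ∀ {s s′} → 2 + s ≤ s′ → s′ ≤ 2 * L → slotNode s ≢ slotNode s′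
  slotNode-separated {s} {s′} s+2≤s′ s′≤2L = by-cases (s′ <? 2 * L)
    where
    open ≤-Reasoning
    s<2L : s < 2 * L
    s<2L = <-≤-trans (≤-trans (n≤1+n _) s+2≤s′) s′≤2L
    by-cases : Dec (s′ < 2 * L) → slotNode s ≢ slotNode s′
    by-cases (yes s′<2L) = <⇒≢ (begin-strict
      slotNode s          ≡⟨ slotNode-leaf s s<2L ⟩
      node (L + ⌊ s /2⌋)  <⟨ node-mono (+-monoʳ-< L (⌊n/2⌋-mono s+2≤s′)) ⟩
      node (L + ⌊ s′ /2⌋) ≡⟨ sym (slotNode-leaf s′ s′<2L) ⟩
      slotNode s′         ∎)
    by-cases (no s′≮2L) = >⇒≢ (begin-strict
      slotNode s′         ≡⟨ cong slotNode (≤-antisym s′≤2L (≮⇒≥ s′≮2L)) ⟩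
      slotNode (2 * L)    ≡⟨ slotNode-root ⟩
      node 1              <⟨ node-mono (<-≤-trans 2≤L (m≤m+n L _)) ⟩
      node (L + ⌊ s /2⌋)  ≡⟨ sym (slotNode-leaf s s<2L) ⟩
      slotNode s          ∎)

  slot-gap : ∀ r {q q′} → q < q′ → 2 + (r + q * m) ≤ r + q′ * m
  slot-gap r {q} {q′} q<q′ = begin
    2 + (r + q * m) ≤⟨ +-monoˡ-≤ (r + q * m) (≤-trans (n≤1+n 2) 3≤m) ⟩
    m + (r + q * m) ≡⟨ shuffle m r (q * m) ⟩
    r + suc q * m   ≤⟨ +-monoʳ-≤ r (*-monoˡ-≤ m q<q′) ⟩
    r + q′ * m      ∎
    where
    open ≤-Reasoning
    shuffle : ∀ a b c → a + (b + c) ≡ b + (a + c)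
    shuffle = solve-∀

  residue : ∀ {r} q → r < m → (r + q * m) % m ≡ r
  residue {r} q r<m = trans ([m+kn]%n≡m%n r q m) (m<n⇒m%n≡m r<m)

  consecutive-residues : ∀ a → a % m ≢ suc a % m
  consecutive-residues a same = by-cases (suc (a % m) <? m)
    where
    open ≡-Reasoning
    next : suc a % m ≡ suc (a % m) % m
    next = begin
      suc a % m                 ≡⟨ %-distribˡ-+ 1 a m ⟩
      (1 % m + a % m) % m       ≡⟨ cong (λ i → (i + a % m) % m) (m<n⇒m%n≡m (≤-trans (s≤s (s≤s z≤n)) 3≤m)) ⟩
      suc (a % m) % m           ∎
    by-cases : Dec (suc (a % m) < m) → ⊥
    by-cases (yes no-wrap) = <⇒≢ (n<1+n (a % m)) (begin
      a % m                     ≡⟨ same ⟩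
      suc a % m                 ≡⟨ next ⟩
      suc (a % m) % m           ≡⟨ m<n⇒m%n≡m no-wrap ⟩
      suc (a % m)               ∎)
    by-cases (no wrap) = <⇒≢ (≤-trans (s≤s (s≤s z≤n)) 3≤m) (begin
      1                         ≡⟨ cong suc (sym a%m≡0) ⟩
      suc (a % m)               ≡⟨ top ⟩
      m                         ∎)
      where
      top : suc (a % m) ≡ m
      top = ≤-antisym (m%n<n a m) (≮⇒≥ wrap)
      a%m≡0 : a % m ≡ 0
      a%m≡0 = begin
        a % m                   ≡⟨ same ⟩
        suc a % m               ≡⟨ next ⟩
        suc (a % m) % m         ≡⟨ cong (_% m) top ⟩
        m % m                   ≡⟨ n%n≡0 m ⟩
        0                       ∎

  in-xNbrs : ∀ r q → q < 3 → slotNode (r + q * m) ∈ xNbrs r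
  in-xNbrs r 0 _ = here refl
  in-xNbrs r 1 _ = there (here refl)
  in-xNbrs r 2 _ = there (there (here refl))
  in-xNbrs r (suc (suc (suc q))) (s≤s (s≤s (s≤s ())))

  slot-forth : ∀ s → s ≤ 2 * L → slotNode s ∈ nbrs (s % m)
  slot-forth s s≤2L = subst₂ _∈_ (cong slotNode (sym (m≡m%n+[m/n]*n s m)))
                        (sym (nbrs-x (s % m) (m%n<n s m)))
                        (in-xNbrs (s % m) (s / m) (m<n*o⇒m/o<n s<3m))
    where
    s<3m : s < 3 * m
    s<3m = subst (s <_) (sym (solve-∀-3m k)) (s≤s s≤2L)
      where
      solve-∀-3m : ∀ k → 3 * suc (2 * k) ≡ suc (2 * suc (3 * k))
      solve-∀-3m = solve-∀

  slot-back : ∀ s → s ≤ 2 * L → s % m ∈ nbrs (slotNode s)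
  slot-back s s≤2L with s <? 2 * L
  ... | yes s<2L = subst (s % m ∈_) (sym (nbrs-leaf ⌊ s /2⌋ (half-< s<2L))) (by-parity (parity s))
    where
    by-parity : s ≡ 2 * ⌊ s /2⌋ ⊎ s ≡ suc (2 * ⌊ s /2⌋) →
      s % m ∈ (2 * ⌊ s /2⌋) % m ∷ (suc (2 * ⌊ s /2⌋)) % m ∷ node ⌊ (L + ⌊ s /2⌋) /2⌋ ∷ []
    by-parity (inj₁ even) = here (cong (_% m) even)
    by-parity (inj₂ odd)  = there (here (cong (_% m) odd))
  ... | no s≮2L = subst (_∈ nbrs (node 1)) root-parent (nbrs-parent 1 ≤-refl)
    where
    root-parent : node 0 ≡ s % m
    root-parent = begin
      2 * k + 0           ≡⟨ +-identityʳ (2 * k) ⟩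
      2 * k               ≡⟨ sym (residue 2 ≤-refl) ⟩
      (2 * k + 2 * m) % m ≡⟨ cong (_% m) x-slots ⟩
      (2 * L) % m         ≡⟨ cong (_% m) (≤-antisym (≮⇒≥ s≮2L) s≤2L) ⟩
      s % m               ∎
      where open ≡-Reasoning

  parent-lists : ∀ j → 1 ≤ j → j < 2 * L → node j ∈ nbrs (node ⌊ j /2⌋)
  parent-lists 1 _ _ = subst₂ _∈_ root-slot (sym (nbrs-x (2 * k + 0) (s≤s (≤-reflexive (+-identityʳ (2 * k))))))
                         (in-xNbrs (2 * k + 0) 2 ≤-refl)
    where
    root-slot : slotNode (2 * k + 0 + 2 * m) ≡ node 1
    root-slot = trans (cong (λ i → slotNode (i + 2 * m)) (+-identityʳ (2 * k)))
                  (trans (cong slotNode x-slots) slotNode-root)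
  parent-lists j@(suc (suc _)) _ j<2L =
    subst (node j ∈_) (sym (nbrs-inner ⌊ j /2⌋ (s≤s z≤n) (half-< j<2L))) (by-parity (parity j))
    where
    by-parity : j ≡ 2 * ⌊ j /2⌋ ⊎ j ≡ suc (2 * ⌊ j /2⌋) →
      node j ∈ node (2 * ⌊ j /2⌋) ∷ node (suc (2 * ⌊ j /2⌋)) ∷ node ⌊ ⌊ j /2⌋ /2⌋ ∷ []
    by-parity (inj₁ even) = here (cong node even)
    by-parity (inj₂ odd)  = there (here (cong node odd))

  child-lists : ∀ {j} c → ⌊ c /2⌋ ≡ j → 1 ≤ c → node j ∈ nbrs (node c)
  child-lists c half 1≤c = subst (λ p → node p ∈ nbrs (node c)) half (nbrs-parent c 1≤c)

  symmetric : ∀ v w → v < n → w ∈ nbrs v → v ∈ nbrs w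
  symmetric v w v<n w∈v with vertex v v<n
  ... | x-vertex r r<m =
    All.lookup {P = λ u → r ∈ nbrs u} (all3 (lists 0 z≤n) (lists 1 (s≤s z≤n)) (lists 2 ≤-refl))
      (subst (w ∈_) (nbrs-x r r<m) w∈v)
    where
    lists : ∀ q → q ≤ 2 → r ∈ nbrs (slotNode (r + q * m))
    lists q q≤2 = subst (_∈ nbrs (slotNode (r + q * m))) (residue q r<m)
                      (slot-back (r + q * m) (slot-bound q r<m q≤2))
  ... | inner j 1≤j j<L =
    All.lookup {P = λ u → node j ∈ nbrs u}
      (all3 (child-lists (2 * j) (half-double j) (≤-trans 1≤j (m≤m+n j _)))
            (child-lists (suc (2 * j)) (half-suc-double j) (s≤s z≤n))
            (parent-lists j 1≤j (≤-trans j<L L≤2L)))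
      (subst (w ∈_) (nbrs-inner j 1≤j j<L) w∈v)
  ... | leaf ℓ ℓ<L =
    All.lookup {P = λ u → node (L + ℓ) ∈ nbrs u}
      (all3 (slot (2 * ℓ) (half-double ℓ) (≤-trans (n≤1+n _) (children-< ℓ<L)))
            (slot (suc (2 * ℓ)) (half-suc-double ℓ) (children-< ℓ<L))
            (parent-lists (L + ℓ) (leaf-≥1 ℓ) (leaf-< ℓ<L)))
      (subst (w ∈_) (nbrs-leaf ℓ ℓ<L) w∈v)
    where
    slot : ∀ s → ⌊ s /2⌋ ≡ ℓ → s < 2 * L → node (L + ℓ) ∈ nbrs (s % m)
    slot s half s<2L = subst (_∈ nbrs (s % m)) (trans (slotNode-leaf s s<2L) (cong (λ p → node (L + p)) half))
                         (slot-forth s (<⇒≤ s<2L))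

  in-range : ∀ v → v < n → All (_< n) (nbrs v)
  in-range v v<n with vertex v v<n
  ... | x-vertex r r<m = subst (All (_< n)) (sym (nbrs-x r r<m))
          (all3 (slot-< (r + 0 * m)) (slot-< (r + 1 * m)) (slot-< (r + 2 * m)))
    where
    slot-< : ∀ s → slotNode s < n
    slot-< s = proj₂ (slotNode-range s)
  ... | inner j 1≤j j<L = subst (All (_< n)) (sym (nbrs-inner j 1≤j j<L))
          (all3 (node-< (≤-trans (n≤1+n _) (children-< j<L))) (node-< (children-< j<L))
                (node-< (≤-<-trans (⌊n/2⌋≤n j) (≤-trans j<L L≤2L))))
  ... | leaf ℓ ℓ<L = subst (All (_< n)) (sym (nbrs-leaf ℓ ℓ<L))
          (all3 (<-≤-trans (m%n<n (2 * ℓ) m) m≤n) (<-≤-trans (m%n<n (suc (2 * ℓ)) m) m≤n)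
                (node-< (≤-<-trans (⌊n/2⌋≤n _) (leaf-< ℓ<L))))

  distinct : ∀ v → v < n → Unique (nbrs v)
  distinct v v<n with vertex v v<n
  ... | x-vertex r r<m = subst Unique (sym (nbrs-x r r<m))
          (distinct3 (separated 0 1 (s≤s z≤n) (s≤s z≤n)) (separated 0 2 (s≤s z≤n) ≤-refl)
                     (separated 1 2 ≤-refl ≤-refl))
    where
    separated : ∀ q q′ → q < q′ → q′ ≤ 2 → slotNode (r + q * m) ≢ slotNode (r + q′ * m)
    separated q q′ q<q′ q′≤2 = slotNode-separated (slot-gap r q<q′) (slot-bound q′ r<m q′≤2)
  ... | inner j 1≤j j<L = subst Unique (sym (nbrs-inner j 1≤j j<L))
          (distinct3 (<⇒≢ (node-mono (n<1+n _))) (>⇒≢ (node-mono parent<2j))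
                     (>⇒≢ (node-mono (≤-trans parent<2j (n≤1+n _)))))
    where
    parent<2j : ⌊ j /2⌋ < 2 * j
    parent<2j = <-≤-trans (half-<-self 1≤j) (m≤m+n j _)
  ... | leaf ℓ ℓ<L = subst Unique (sym (nbrs-leaf ℓ ℓ<L))
          (distinct3 (consecutive-residues (2 * ℓ)) (<⇒≢ (x<node (m%n<n (2 * ℓ) m) parent≥1))
                     (<⇒≢ (x<node (m%n<n (suc (2 * ℓ)) m) parent≥1)))
    where
    parent≥1 : 1 ≤ ⌊ (L + ℓ) /2⌋
    parent≥1 = ⌊n/2⌋-mono (≤-trans 2≤L (m≤m+n L ℓ))

  loopless : ∀ v → v < n → v ∉ nbrs v
  loopless v v<n with vertex v v<n
  ... | x-vertex r r<m = subst (r ∉_) (sym (nbrs-x r r<m))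
          (not-in3 (below (r + 0 * m)) (below (r + 1 * m)) (below (r + 2 * m)))
    where
    below : ∀ s → r ≢ slotNode s
    below s = <⇒≢ (<-≤-trans r<m (proj₁ (slotNode-range s)))
  ... | inner j 1≤j j<L = subst (node j ∉_) (sym (nbrs-inner j 1≤j j<L))
          (not-in3 (<⇒≢ (node-mono (m<m+n j (≤-trans 1≤j (m≤m+n j 0)))))
                   (<⇒≢ (node-mono (s≤s (m≤m+n j _))))
                   (>⇒≢ (node-mono (half-<-self 1≤j))))
  ... | leaf ℓ ℓ<L = subst (node (L + ℓ) ∉_) (sym (nbrs-leaf ℓ ℓ<L))
          (not-in3 (>⇒≢ (x<node (m%n<n (2 * ℓ) m) (leaf-≥1 ℓ)))
                   (>⇒≢ (x<node (m%n<n (suc (2 * ℓ)) m) (leaf-≥1 ℓ)))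
                   (>⇒≢ (node-mono (half-<-self (leaf-≥1 ℓ)))))

  three-neighbours : ∀ v → v < n → length (nbrs v) ≡ 3
  three-neighbours v v<n with vertex v v<n
  ... | x-vertex r r<m  = cong length (nbrs-x r r<m)
  ... | inner j 1≤j j<L = cong length (nbrs-inner j 1≤j j<L)
  ... | leaf ℓ ℓ<L      = cong length (nbrs-leaf ℓ ℓ<L)

  system : NeighbourSystem n
  system = record
    { nbrs = nbrs ; in-range = in-range ; distinct = distinct
    ; loopless = loopless ; symmetric = symmetric }

  lay : ℕ → ℕ
  lay v with v <? m
  ... | yes _ = 0
  ... | no _  = suc h ∸ ⌊log₂ (v ∸ 2 * k) ⌋

  lay-x : ∀ r → r < m → lay r ≡ 0
  lay-x r r<m with r <? m
  ... | yes _  = refl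
  ... | no r≮m = contradiction r<m r≮m

  lay-node : ∀ j → 1 ≤ j → lay (node j) ≡ suc h ∸ ⌊log₂ j ⌋
  lay-node j 1≤j with node j <? m
  ... | yes j<m = contradiction (node-≥m 1≤j) (<⇒≱ j<m)
  ... | no _    = cong (λ i → suc h ∸ ⌊log₂ i ⌋) (m+n∸m≡n (2 * k) j)

  lay-≤ : ∀ v → v < n → lay v ≤ suc h
  lay-≤ v _ with v <? m
  ... | yes _ = z≤n
  ... | no _  = m∸n≤m (suc h) ⌊log₂ (v ∸ 2 * k) ⌋

  2L≡2^[1+h] : 2 * L ≡ 2 ^ suc h
  2L≡2^[1+h] = cong (2 *_) L≡2^h

  lay-node-suc : ∀ j → 1 ≤ j → j < 2 * L → lay (node j) ≡ suc (h ∸ ⌊log₂ j ⌋)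
  lay-node-suc j 1≤j j<2L =
    trans (lay-node j 1≤j) (+-∸-assoc 1 (⌊log₂⌋-< h j (subst (j <_) 2L≡2^[1+h] j<2L)))

  lay-parent : ∀ c → 2 ≤ c → c < 2 * L → lay (node ⌊ c /2⌋) ≡ suc (lay (node c))
  lay-parent c 2≤c c<2L = begin
    lay (node ⌊ c /2⌋)                ≡⟨ lay-node-suc ⌊ c /2⌋ (⌊n/2⌋-mono 2≤c) (≤-<-trans (⌊n/2⌋≤n c) c<2L) ⟩
    suc (suc h ∸ suc ⌊log₂ ⌊ c /2⌋ ⌋) ≡⟨ cong (λ l → suc (suc h ∸ l)) (sym (⌊log₂⌋-half c 2≤c)) ⟩
    suc (suc h ∸ ⌊log₂ c ⌋)           ≡⟨ cong suc (sym (lay-node c (≤-trans (n≤1+n 1) 2≤c))) ⟩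
    suc (lay (node c))                ∎
    where open ≡-Reasoning

  lay-leaf : ∀ ℓ → ℓ < L → lay (node (L + ℓ)) ≡ 1
  lay-leaf ℓ ℓ<L = begin
    lay (node (L + ℓ))        ≡⟨ lay-node-suc (L + ℓ) (leaf-≥1 ℓ) (leaf-< ℓ<L) ⟩
    suc (h ∸ ⌊log₂ (L + ℓ) ⌋) ≡⟨ cong (λ l → suc (h ∸ l)) depth ⟩
    suc (h ∸ h)               ≡⟨ cong suc (n∸n≡0 h) ⟩
    1                         ∎
    where
    open ≡-Reasoning
    depth : ⌊log₂ (L + ℓ) ⌋ ≡ h
    depth = ⌊log₂⌋-exact h (L + ℓ) (subst (_≤ L + ℓ) L≡2^h (m≤m+n L ℓ))
              (subst (L + ℓ <_) 2L≡2^[1+h] (leaf-< ℓ<L))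

  two-below : ∀ v i → v < n → lay v ≡ suc i → 2 ≤ length (filter (λ w → lay w ≟ i) (nbrs v))
  two-below v i v<n lay-v with vertex v v<n
  ... | x-vertex r r<m  = contradiction (trans (sym (lay-x r r<m)) lay-v) 0≢1+n
  ... | inner j 1≤j j<L = two-in-layer lay (nbrs-inner j 1≤j j<L)
          (child (2 * j) (half-double j) 2≤2j (≤-trans (n≤1+n _) (children-< j<L)))
          (child (suc (2 * j)) (half-suc-double j) (≤-trans 2≤2j (n≤1+n _)) (children-< j<L))
    where
    2≤2j : 2 ≤ 2 * j
    2≤2j = *-monoʳ-≤ 2 1≤j
    child : ∀ c → ⌊ c /2⌋ ≡ j → 2 ≤ c → c < 2 * L → lay (node c) ≡ i
    child c half 2≤c c<2L =
      suc-injective (trans (sym (lay-parent c 2≤c c<2L)) (trans (cong (λ p → lay (node p)) half) lay-v))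
  ... | leaf ℓ ℓ<L      = two-in-layer lay (nbrs-leaf ℓ ℓ<L)
          (x-in-0 ((2 * ℓ) % m) (m%n<n (2 * ℓ) m)) (x-in-0 ((suc (2 * ℓ)) % m) (m%n<n (suc (2 * ℓ)) m))
    where
    x-in-0 : ∀ r → r < m → lay r ≡ i
    x-in-0 r r<m = trans (lay-x r r<m) (suc-injective (trans (sym (lay-leaf ℓ ℓ<L)) lay-v))

  inhabited : ∀ i → i ≤ suc h → ∃[ v ] v < n × lay v ≡ i
  inhabited zero _ = 0 , <-≤-trans (s≤s z≤n) m≤n , lay-x 0 (s≤s z≤n)
  inhabited (suc i) (s≤s i≤h) = node (2 ^ (h ∸ i)) , node-< j<2L , (begin
      lay (node (2 ^ (h ∸ i)))          ≡⟨ lay-node-suc (2 ^ (h ∸ i)) (m^n>0 2 (h ∸ i)) j<2L ⟩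
      suc (h ∸ ⌊log₂ (2 ^ (h ∸ i)) ⌋)   ≡⟨ cong (λ l → suc (h ∸ l)) (⌊log₂[2^n]⌋≡n (h ∸ i)) ⟩
      suc (h ∸ (h ∸ i))                 ≡⟨ cong suc (m∸[m∸n]≡n i≤h) ⟩
      suc i                             ∎)
    where
    open ≡-Reasoning
    j<2L : 2 ^ (h ∸ i) < 2 * L
    j<2L = ≤-<-trans (subst (2 ^ (h ∸ i) ≤_) (sym L≡2^h) (^-monoʳ-≤ 2 (m∸n≤m h i))) (m<m+n L (s≤s z≤n))

  layer-zero : ∀ v → v < n → lay v ≡ 0 → v ∈ upTo m
  layer-zero v v<n lay-v with vertex v v<n
  ... | x-vertex r r<m  = ∈-upTo⁺ r<m
  ... | inner j 1≤j j<L = contradiction (trans (sym lay-v) (lay-node-suc j 1≤j (≤-trans j<L L≤2L))) 0≢1+n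
  ... | leaf ℓ ℓ<L      = contradiction (trans (sym lay-v) (lay-leaf ℓ ℓ<L)) 0≢1+n

proposition1 : (k t : ℕ) → k ≥ 1 → t ≥ 1 → 3 * k + 1 ≡ 2 ^ (t ∸ 1) →
    Σ (Graph (8 * k + 2)) λ G → Cubic G ×
      Σ ℕ λ d → 4 * d ≡ (8 * k + 2) + 2 × HasWDMOfSize G (λ _ → 2) t d
proposition1 k zero _ () _
proposition1 k (suc h) k≥1 _ leaves =
  systemGraph system , cubic , m , size , layerMap , layerMap-WDM 2 inhabited two-below , layer-0-size
  where
  open Construction k h k≥1 leaves
  open Layering system (suc h) lay lay-≤
  cubic : Cubic (systemGraph system)
  cubic v = trans (systemGraph-degree system v) (three-neighbours (toℕ v) (toℕ<n v))
  layer-0-size : layerSize layerMap 0 ≡ m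
  layer-0-size = trans (layerSize-layerMap 0 (upTo m) (Unique.upTo⁺ m)
                         (All.tabulate (λ v∈ → <-≤-trans (∈-upTo⁻ v∈) m≤n))
                         layer-zero (λ v v∈ → lay-x v (∈-upTo⁻ v∈)))
                   (length-upTo m)
  size : 4 * m ≡ (8 * k + 2) + 2
  size = solve-∀-size k
    where
    solve-∀-size : ∀ k → 4 * suc (2 * k) ≡ (8 * k + 2) + 2
    solve-∀-size = solve-∀
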